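{- Let $r\ge 0$ be an integer, $R=2^r$, $W=\sqrt{R^2+2R}$, $\lambda=\frac{R+W}{2}$, $\mu=\frac{R-W}{2}$, and for every integer $n$ let $P_R(n)=\frac{2}{RW}(\lambda^n-\mu^n)$. Then for all integers $m\ge0$ and $n\ge0$, \[ P_R(n)^{2m+1}=\frac{2^{2m}}{R^{3m}(R+2)^{m}}\sum_{j=0}^m(-1)^j\binom{2m+1}{j}P_R\bigl((2m+1-2j)n\bigr)\Bigl(-\frac R2\Bigr)^{jn}. \]
   Context: $P_R(n)$ are the (shifted) generalized $r$-Pell numbers, with $P_R(0)=0$, $P_R(1)=2/R$, $P_R(2)=2$ and $2P_R(n+2)=2RP_R(n+1)+RP_R(n)$. -}

module Defs where

open import Data.Nat as ℕ using (ℕ; zero; suc)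
open import Data.Nat.Properties using (m^n≢0; m*n≢0)
open import Data.Nat.Combinatorics using (_C_)
open import Data.Integer using (+_)
open import Data.Rational using (ℚ; 0ℚ; 1ℚ; _/_; _+_; _*_; -_)

Rℕ : ℕ → ℕ
Rℕ r = 2 ℕ.^ r

Rq : ℕ → ℚ
Rq r = (+ Rℕ r) / 1

twoOverR : ℕ → ℚ
twoOverR r = _/_ (+ 2) (Rℕ r) {{m^n≢0 2 r}}

ROverTwo : ℕ → ℚ
ROverTwo r = (+ Rℕ r) / 2

P : ℕ → ℕ → ℚ
P r zero = 0ℚ
P r (suc zero) = twoOverR r
P r (suc (suc n)) = Rq r * P r (suc n) + ROverTwo r * P r n

_^_ : ℚ → ℕ → ℚ
x ^ zero = 1ℚ
x ^ suc n = x * (x ^ n)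

Σ≤ : ℕ → (ℕ → ℚ) → ℚ
Σ≤ zero f = f 0
Σ≤ (suc m) f = Σ≤ m f + f (suc m)

prefactor : ℕ → ℕ → ℚ
prefactor r m =
  _/_ (+ (2 ℕ.^ (2 ℕ.* m))) (Rℕ r ℕ.^ (3 ℕ.* m) ℕ.* (2 ℕ.+ Rℕ r) ℕ.^ m)
      {{m*n≢0 (Rℕ r ℕ.^ (3 ℕ.* m)) ((2 ℕ.+ Rℕ r) ℕ.^ m)
         {{m^n≢0 (Rℕ r) (3 ℕ.* m) {{m^n≢0 2 r}}}} {{m^n≢0 (2 ℕ.+ Rℕ r) m}}}}

ℕ→ℚ : ℕ → ℚ
ℕ→ℚ k = (+ k) / 1

-- Let κ = prefactor r 1 = 4/(R³(R+2)), whose square root is s = 2/(RW), and let λ, μ = R/2 ± ωs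
-- with ωs = W/2. Working in ℚ[√κ] = ℚ × ℚ, λ and μ are the roots of x² = Rx + R/2 and
-- s(λ - μ) = 2/R, so the recurrence gives the Binet formula P(n) = s(λⁿ - μⁿ). Then
-- P(n)^(2m+1) = s^(2m+1) (a - b)^(2m+1) = κ^m · s (a - b)^(2m+1) with a = λⁿ, b = μⁿ. In the
-- binomial expansion of (a - b)^(2m+1) the terms j and 2m+1-j combine, because 2m+1-2j is odd, to
-- (-1)^j C(2m+1,j) (ab)^j (a^(2m+1-2j) - b^(2m+1-2j)); since ab = (λμ)ⁿ = (-R/2)ⁿ and
-- s(a^e - b^e) = P(en), multiplying by s gives the sum, and κ^m is the prefactor. The identity
-- holds in ℚ[√κ] and is read off in the first coordinate.
module Submission where

open import Data.Nat using (ℕ; _∸_) renaming (_*_ to _*ℕ_; _+_ to _+ℕ_)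
open import Data.Nat.Combinatorics using (_C_)
open import Relation.Binary.PropositionalEquality using (_≡_)

open import Algebra.Bundles using (CommutativeMonoid; CommutativeRing)
import Algebra.Solver.CommutativeMonoid as CM-Solver
open import Data.Fin using (toℕ)
open import Data.Nat as ℕ using (zero; suc; _≤_; z≤n)
import Data.Nat.Properties as ℕ
open import Data.Nat.Combinatorics using (nCk≡nC[n∸k])
import Data.Nat.Tactic.RingSolver as ℕ-Solver
open import Function using (_∘_)
import Relation.Binary.PropositionalEquality as ≡

j+e+j≡2j+e : ∀ j e → j +ℕ e +ℕ j ≡ 2 *ℕ j +ℕ e
j+e+j≡2j+e = ℕ-Solver.solve-∀

2m+1≡1+m+m : ∀ m → 2 *ℕ m +ℕ 1 ≡ suc (m +ℕ m)
2m+1≡1+m+m = ℕ-Solver.solve-∀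

2m+1≡j+odd+j : ∀ {j m} → j ≤ m → 2 *ℕ m +ℕ 1 ≡ j +ℕ suc ((m ∸ j) +ℕ (m ∸ j)) +ℕ j
2m+1≡j+odd+j {j} {m} j≤m =
  ≡.trans (≡.cong (λ k → 2 *ℕ k +ℕ 1) (≡.sym (ℕ.m+[n∸m]≡n j≤m))) (split j (m ∸ j))
  where
  split : ∀ j t → 2 *ℕ (j +ℕ t) +ℕ 1 ≡ j +ℕ suc (t +ℕ t) +ℕ j
  split = ℕ-Solver.solve-∀

module BoundedSum {c ℓ} (M : CommutativeMonoid c ℓ) where

  open CommutativeMonoid M renaming (_∙_ to _+_)
  open import Algebra.Properties.Monoid.Sum monoid using (sum)
  open import Relation.Binary.Reasoning.Setoid setoid
  open CM-Solver M using (solve; _⊕_; _⊜_)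

  ∑≤ : ℕ → (ℕ → Carrier) → Carrier
  ∑≤ zero    f = f 0
  ∑≤ (suc m) f = ∑≤ m f + f (suc m)

  ∑≤-cong : ∀ m {f g} → (∀ j → j ≤ m → f j ≈ g j) → ∑≤ m f ≈ ∑≤ m g
  ∑≤-cong zero    f≈g = f≈g 0 z≤n
  ∑≤-cong (suc m) f≈g = ∙-cong (∑≤-cong m (λ j j≤m → f≈g j (ℕ.m≤n⇒m≤1+n j≤m))) (f≈g (suc m) ℕ.≤-refl)

  ∑≤-suc : ∀ m f → ∑≤ (suc m) f ≈ f 0 + ∑≤ m (f ∘ suc)
  ∑≤-suc zero    f = refl
  ∑≤-suc (suc m) f = trans (∙-congʳ (∑≤-suc m f)) (assoc _ _ _)

  sum≈∑≤ : ∀ n f → sum {suc n} (f ∘ toℕ) ≈ ∑≤ n f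
  sum≈∑≤ zero    f = identityʳ (f 0)
  sum≈∑≤ (suc n) f = trans (∙-congˡ (sum≈∑≤ n (f ∘ suc))) (sym (∑≤-suc n f))

  ∑≤-fold : ∀ m f → ∑≤ (suc (m +ℕ m)) f ≈ ∑≤ m (λ j → f j + f (suc (m +ℕ m) ∸ j))
  ∑≤-fold zero    f = refl
  ∑≤-fold (suc m) f rewrite ℕ.+-suc m m = begin
    ∑≤ (suc (suc n)) f + f last
      ≈⟨ ∙-congʳ (∑≤-suc (suc n) f) ⟩
    (f 0 + ∑≤ (suc n) (f ∘ suc)) + f last
      ≈⟨ ∙-congʳ (∙-congˡ (∑≤-fold m (f ∘ suc))) ⟩
    (f 0 + ∑≤ m (λ j → f (suc j) + f (suc (suc n ∸ j)))) + f last
      ≈⟨ swap (f 0) _ (f last) ⟩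
    (f 0 + f last) + ∑≤ m (λ j → f (suc j) + f (suc (suc n ∸ j)))
      ≈⟨ ∙-congˡ (∑≤-cong m (λ j j≤m → ∙-congˡ (reflexive (≡.cong f (reindex j j≤m))))) ⟩
    (f 0 + f last) + ∑≤ m (λ j → f (suc j) + f (last ∸ suc j))
      ≈⟨ sym (∑≤-suc m _) ⟩
    ∑≤ (suc m) (λ j → f j + f (last ∸ j)) ∎
    where
    n = m +ℕ m
    last = suc (suc (suc n))
    swap : ∀ x y z → (x + y) + z ≈ (x + z) + y
    swap = solve 3 (λ x y z → (x ⊕ y) ⊕ z ⊜ (x ⊕ z) ⊕ y) refl
    reindex : ∀ j → j ≤ m → suc (suc n ∸ j) ≡ suc (suc n) ∸ j
    reindex j j≤m = ≡.sym (ℕ.+-∸-assoc 1 (ℕ.m≤n⇒m≤1+n (ℕ.≤-trans j≤m (ℕ.m≤m+n m m))))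

module OddPowers {c ℓ} (𝓡 : CommutativeRing c ℓ) where

  open CommutativeRing 𝓡
  open import Algebra.Properties.Ring ring
    using (-1*x≈-x; -‿distribˡ-*; -‿distribʳ-*; -‿involutive; -‿+-comm; x[y-z]≈xy-xz)
  open import Algebra.Properties.Semiring.Exp semiring using (_^_; ^-homo-*; ^-congˡ; ^-congʳ; ^-assocʳ)
  open import Algebra.Properties.CommutativeSemiring.Exp commutativeSemiring using (^-distrib-*)
  open import Algebra.Properties.Semiring.Mult semiring using (_×_; ×-congʳ; ×-comm-*; ×-assoc-*)
  open import Algebra.Properties.CommutativeMonoid.Mult +-commutativeMonoid using (×-distrib-+)
  import Algebra.Properties.CommutativeSemiring.Binomial commutativeSemiring as Binomial
  open import Relation.Binary.Reasoning.Setoid setoid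
  open BoundedSum +-commutativeMonoid public
  private
    module +-Solver = CM-Solver +-commutativeMonoid
    module *-Solver = CM-Solver *-commutativeMonoid

  *-distribˡ-∑≤ : ∀ m x f → x * ∑≤ m f ≈ ∑≤ m (λ j → x * f j)
  *-distribˡ-∑≤ zero    x f = refl
  *-distribˡ-∑≤ (suc m) x f = trans (distribˡ x _ _) (+-congʳ (*-distribˡ-∑≤ m x f))

  ×≈×1#* : ∀ k x → k × x ≈ k × 1# * x
  ×≈×1#* k x = sym (trans (×-assoc-* k 1# x) (×-congʳ k (*-identityˡ x)))

  -x*-y≈x*y : ∀ x y → - x * - y ≈ x * y
  -x*-y≈x*y x y = begin
    - x * - y     ≈⟨ -‿distribˡ-* x (- y) ⟨
    - (x * - y)   ≈⟨ -‿cong (-‿distribʳ-* x y) ⟨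
    - - (x * y)   ≈⟨ -‿involutive (x * y) ⟩
    x * y         ∎

  -‿^-odd : ∀ t x → (- x) ^ suc (t +ℕ t) ≈ - (x ^ suc (t +ℕ t))
  -‿^-odd zero    x = trans (*-identityʳ (- x)) (-‿cong (sym (*-identityʳ x)))
  -‿^-odd (suc t) x rewrite ℕ.+-suc t t =
    trans (*-congˡ (trans (*-congˡ (-‿^-odd t x)) (-x*-y≈x*y x _))) (sym (-‿distribˡ-* x _))

  -‿^ : ∀ j x → (- x) ^ j ≈ (- 1#) ^ j * x ^ j
  -‿^ j x = trans (^-congˡ j (sym (-1*x≈-x x))) (^-distrib-* (- 1#) x j)

  x*[y*z]≈y*[x*z] : ∀ x y z → x * (y * z) ≈ y * (x * z)
  x*[y*z]≈y*[x*z] = solve 3 (λ x y z → x ⊕ (y ⊕ z) ⊜ y ⊕ (x ⊕ z)) refl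
    where open *-Solver

  module _ (a b : Carrier) where

    -- Definitionally Binomial.binomialTerm (- b) a, indexed by ℕ instead of Fin.
    binomialTerm : ℕ → ℕ → Carrier
    binomialTerm n j = (n C j) × ((- b) ^ j * a ^ (n ∸ j))

    binomialTerm-pair : ∀ {n} j t → n ≡ j +ℕ suc (t +ℕ t) +ℕ j →
      binomialTerm n j + binomialTerm n (n ∸ j)
        ≈ (n C j) × ((- 1#) ^ j * (a * b) ^ j * (a ^ (n ∸ 2 *ℕ j) - b ^ (n ∸ 2 *ℕ j)))
    binomialTerm-pair {n} j t ≡.refl = begin
      binomialTerm n j + binomialTerm n (n ∸ j)
        ≡⟨ ≡.cong₂ (λ k i → (n C j) × ((- b) ^ j * a ^ k) + (n C k) × ((- b) ^ k * a ^ i))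
                   n∸j≡j+e n∸[n∸j]≡j ⟩
      (n C j) × ((- b) ^ j * a ^ (j +ℕ e)) + (n C (j +ℕ e)) × ((- b) ^ (j +ℕ e) * a ^ j)
        ≡⟨ ≡.cong (λ k → (n C j) × ((- b) ^ j * a ^ (j +ℕ e)) + k × ((- b) ^ (j +ℕ e) * a ^ j)) nC[j+e]≡nCj ⟩
      (n C j) × ((- b) ^ j * a ^ (j +ℕ e)) + (n C j) × ((- b) ^ (j +ℕ e) * a ^ j)
        ≈⟨ ×-distrib-+ _ _ (n C j) ⟨
      (n C j) × ((- b) ^ j * a ^ (j +ℕ e) + (- b) ^ (j +ℕ e) * a ^ j)
        ≈⟨ ×-congʳ (n C j) (+-cong (*-congˡ (^-homo-* a j e)) (*-congʳ (^-homo-* (- b) j e))) ⟩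
      (n C j) × ((- b) ^ j * (a ^ j * a ^ e) + (- b) ^ j * (- b) ^ e * a ^ j)
        ≈⟨ ×-congʳ (n C j) (+-cong (*-congʳ (-‿^ j b)) (*-congʳ (*-cong (-‿^ j b) (-‿^-odd t b)))) ⟩
      (n C j) × ((- 1#) ^ j * b ^ j * (a ^ j * a ^ e) + (- 1#) ^ j * b ^ j * - b ^ e * a ^ j)
        ≈⟨ ×-congʳ (n C j) (collect ((- 1#) ^ j) (a ^ j) (b ^ j) (a ^ e) (b ^ e)) ⟩
      (n C j) × ((- 1#) ^ j * (a ^ j * b ^ j) * (a ^ e - b ^ e))
        ≈⟨ ×-congʳ (n C j) (*-congʳ (*-congˡ (^-distrib-* a b j))) ⟨
      (n C j) × ((- 1#) ^ j * (a * b) ^ j * (a ^ e - b ^ e))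
        ≡⟨ ≡.cong (λ k → (n C j) × ((- 1#) ^ j * (a * b) ^ j * (a ^ k - b ^ k))) n∸2j≡e ⟨
      (n C j) × ((- 1#) ^ j * (a * b) ^ j * (a ^ (n ∸ 2 *ℕ j) - b ^ (n ∸ 2 *ℕ j))) ∎
      where
      e = suc (t +ℕ t)
      n∸j≡j+e : n ∸ j ≡ j +ℕ e
      n∸j≡j+e = ℕ.m+n∸n≡m (j +ℕ e) j
      n∸[n∸j]≡j : n ∸ (n ∸ j) ≡ j
      n∸[n∸j]≡j = ≡.trans (≡.cong (n ∸_) n∸j≡j+e) (ℕ.m+n∸m≡n (j +ℕ e) j)
      nC[j+e]≡nCj : n C (j +ℕ e) ≡ n C j
      nC[j+e]≡nCj = ≡.trans (≡.cong (n C_) (≡.sym n∸j≡j+e)) (≡.sym (nCk≡nC[n∸k] (ℕ.m≤n+m j (j +ℕ e))))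
      n∸2j≡e : n ∸ 2 *ℕ j ≡ e
      n∸2j≡e = ≡.trans (≡.cong (_∸ 2 *ℕ j) (j+e+j≡2j+e j e)) (ℕ.m+n∸m≡n (2 *ℕ j) e)
      collect : ∀ σ A B E F → σ * B * (A * E) + σ * B * - F * A ≈ σ * (A * B) * (E - F)
      collect σ A B E F = trans (+-cong (regroup σ A B E) (regroup′ σ A B (- F))) (sym (distribˡ _ E (- F)))
        where
        open *-Solver
        regroup : ∀ σ A B E → σ * B * (A * E) ≈ σ * (A * B) * E
        regroup = solve 4 (λ σ A B E → (σ ⊕ B) ⊕ (A ⊕ E) ⊜ (σ ⊕ (A ⊕ B)) ⊕ E) refl
        regroup′ : ∀ σ A B E → σ * B * E * A ≈ σ * (A * B) * E
        regroup′ = solve 4 (λ σ A B E → ((σ ⊕ B) ⊕ E) ⊕ A ⊜ (σ ⊕ (A ⊕ B)) ⊕ E) refl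

    odd-binomial : ∀ m → (a - b) ^ (2 *ℕ m +ℕ 1) ≈
      ∑≤ m (λ j → ((2 *ℕ m +ℕ 1) C j) ×
                  ((- 1#) ^ j * (a * b) ^ j * (a ^ (2 *ℕ m +ℕ 1 ∸ 2 *ℕ j) - b ^ (2 *ℕ m +ℕ 1 ∸ 2 *ℕ j))))
    odd-binomial m = begin
      (a - b) ^ n                                     ≈⟨ ^-congˡ n (+-comm a (- b)) ⟩
      (- b + a) ^ n                                   ≈⟨ Binomial.theorem n (- b) a ⟩
      Binomial.binomialExpansion (- b) a n            ≈⟨ sum≈∑≤ n (binomialTerm n) ⟩
      ∑≤ n (binomialTerm n)                           ≡⟨ ≡.cong (λ k → ∑≤ k (binomialTerm n)) (2m+1≡1+m+m m) ⟩
      ∑≤ (suc (m +ℕ m)) (binomialTerm n)              ≈⟨ ∑≤-fold m (binomialTerm n) ⟩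
      ∑≤ m (λ j → binomialTerm n j + binomialTerm n (suc (m +ℕ m) ∸ j))
        ≡⟨ ≡.cong (λ k → ∑≤ m (λ j → binomialTerm n j + binomialTerm n (k ∸ j))) (2m+1≡1+m+m m) ⟨
      ∑≤ m (λ j → binomialTerm n j + binomialTerm n (n ∸ j))
        ≈⟨ ∑≤-cong m (λ j j≤m → binomialTerm-pair j (m ∸ j) (2m+1≡j+odd+j j≤m)) ⟩
      _ ∎
      where n = 2 *ℕ m +ℕ 1

  module _ (s φ ψ : Carrier) where

    binet : ℕ → Carrier
    binet n = s * (φ ^ n - ψ ^ n)

    binet-zero : binet 0 ≈ 0#
    binet-zero = trans (*-congˡ (-‿inverseʳ 1#)) (zeroʳ s)

    binet-recurrence : ∀ ρ h → φ * φ ≈ ρ * φ + h → ψ * ψ ≈ ρ * ψ + h →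
                       ∀ n → binet (suc (suc n)) ≈ ρ * binet (suc n) + h * binet n
    binet-recurrence ρ h φ² ψ² n = begin
      s * (φ ^ suc (suc n) - ψ ^ suc (suc n))
        ≈⟨ *-congˡ (+-cong (step φ φ²) (-‿cong (step ψ ψ²))) ⟩
      s * ((ρ * φ ^ suc n + h * φ ^ n) - (ρ * ψ ^ suc n + h * ψ ^ n))
        ≈⟨ *-congˡ (interchange (ρ * φ ^ suc n) (h * φ ^ n) (ρ * ψ ^ suc n) (h * ψ ^ n)) ⟩
      s * ((ρ * φ ^ suc n - ρ * ψ ^ suc n) + (h * φ ^ n - h * ψ ^ n))
        ≈⟨ *-congˡ (+-cong (x[y-z]≈xy-xz ρ _ _) (x[y-z]≈xy-xz h _ _)) ⟨
      s * (ρ * (φ ^ suc n - ψ ^ suc n) + h * (φ ^ n - ψ ^ n))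
        ≈⟨ distribˡ s _ _ ⟩
      s * (ρ * (φ ^ suc n - ψ ^ suc n)) + s * (h * (φ ^ n - ψ ^ n))
        ≈⟨ +-cong (x*[y*z]≈y*[x*z] s ρ _) (x*[y*z]≈y*[x*z] s h _) ⟩
      ρ * binet (suc n) + h * binet n ∎
      where
      step : ∀ x → x * x ≈ ρ * x + h → x ^ suc (suc n) ≈ ρ * x ^ suc n + h * x ^ n
      step x x² = begin
        x * (x * x ^ n)           ≈⟨ *-assoc x x (x ^ n) ⟨
        (x * x) * x ^ n           ≈⟨ *-congʳ x² ⟩
        (ρ * x + h) * x ^ n       ≈⟨ distribʳ (x ^ n) (ρ * x) h ⟩
        ρ * x * x ^ n + h * x ^ n ≈⟨ +-congʳ (*-assoc ρ x (x ^ n)) ⟩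
        ρ * x ^ suc n + h * x ^ n ∎
      interchange : ∀ p q p′ q′ → (p + q) - (p′ + q′) ≈ (p - p′) + (q - q′)
      interchange p q p′ q′ = trans (+-congˡ (sym (-‿+-comm p′ q′)))
        (solve 4 (λ p q p′ q′ → (p ⊕ q) ⊕ (p′ ⊕ q′) ⊜ (p ⊕ p′) ⊕ (q ⊕ q′)) refl p q (- p′) (- q′))
        where open +-Solver

    binet-odd-power : ∀ m n → binet n ^ (2 *ℕ m +ℕ 1) ≈
      (s * s) ^ m * ∑≤ m (λ j → (- 1#) ^ j * ((2 *ℕ m +ℕ 1) C j) × 1#
                                 * binet ((2 *ℕ m +ℕ 1 ∸ 2 *ℕ j) *ℕ n) * (φ * ψ) ^ (j *ℕ n))
    binet-odd-power m n = begin
      (s * (a - b)) ^ k                   ≈⟨ ^-distrib-* s (a - b) k ⟩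
      s ^ k * (a - b) ^ k                 ≈⟨ *-cong s^k≈s*[s*s]^m (odd-binomial a b m) ⟩
      s * (s * s) ^ m * ∑≤ m T            ≈⟨ trans (*-assoc _ _ _) (x*[y*z]≈y*[x*z] s _ _) ⟩
      (s * s) ^ m * (s * ∑≤ m T)          ≈⟨ *-congˡ (*-distribˡ-∑≤ m s T) ⟩
      (s * s) ^ m * ∑≤ m (λ j → s * T j)  ≈⟨ *-congˡ (∑≤-cong m (λ j _ → rearrange j)) ⟩
      _                                   ∎
      where
      k = 2 *ℕ m +ℕ 1
      a = φ ^ n
      b = ψ ^ n
      T : ℕ → Carrier
      T j = (k C j) × ((- 1#) ^ j * (a * b) ^ j * (a ^ (k ∸ 2 *ℕ j) - b ^ (k ∸ 2 *ℕ j)))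
      s^k≈s*[s*s]^m : s ^ k ≈ s * (s * s) ^ m
      s^k≈s*[s*s]^m = trans (^-congʳ s (2m+1≡1+m+m m))
                            (*-congˡ (trans (^-homo-* s m m) (sym (^-distrib-* s s m))))
      [x^n]^e≈x^[e*n] : ∀ x e → (x ^ n) ^ e ≈ x ^ (e *ℕ n)
      [x^n]^e≈x^[e*n] x e = trans (^-assocʳ x n e) (^-congʳ x (ℕ.*-comm n e))
      rearrange : ∀ j → s * T j ≈ (- 1#) ^ j * (k C j) × 1# * binet ((k ∸ 2 *ℕ j) *ℕ n) * (φ * ψ) ^ (j *ℕ n)
      rearrange j = begin
        s * (k C j) × (σ * (a * b) ^ j * (a ^ e - b ^ e))
          ≈⟨ ×-comm-* (k C j) s _ ⟩
        (k C j) × (s * (σ * (a * b) ^ j * (a ^ e - b ^ e)))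
          ≈⟨ ×≈×1#* (k C j) _ ⟩
        (k C j) × 1# * (s * (σ * (a * b) ^ j * (a ^ e - b ^ e)))
          ≈⟨ *-congˡ (*-congˡ (*-cong (*-congˡ ab^j≈[φψ]^jn)
                                      (+-cong ([x^n]^e≈x^[e*n] φ e) (-‿cong ([x^n]^e≈x^[e*n] ψ e))))) ⟩
        (k C j) × 1# * (s * (σ * (φ * ψ) ^ (j *ℕ n) * (φ ^ (e *ℕ n) - ψ ^ (e *ℕ n))))
          ≈⟨ shuffle ((k C j) × 1#) s σ ((φ * ψ) ^ (j *ℕ n)) (φ ^ (e *ℕ n) - ψ ^ (e *ℕ n)) ⟩
        σ * (k C j) × 1# * binet (e *ℕ n) * (φ * ψ) ^ (j *ℕ n) ∎
        where
        σ = (- 1#) ^ j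
        e = k ∸ 2 *ℕ j
        ab^j≈[φψ]^jn : (a * b) ^ j ≈ (φ * ψ) ^ (j *ℕ n)
        ab^j≈[φψ]^jn = trans (^-congˡ j (sym (^-distrib-* φ ψ n))) ([x^n]^e≈x^[e*n] (φ * ψ) j)
        shuffle : ∀ c s σ Q D → c * (s * (σ * Q * D)) ≈ σ * c * (s * D) * Q
        shuffle = solve 5 (λ c s σ Q D → c ⊕ (s ⊕ ((σ ⊕ Q) ⊕ D)) ⊜ ((σ ⊕ c) ⊕ (s ⊕ D)) ⊕ Q) refl
          where open *-Solver

open import Defs
open import Data.Rational using (ℚ; _*_; -_; 1ℚ)
open import Algebra.Structures using (IsCommutativeRing)
open import Data.Integer as ℤ using (+_)
import Data.Integer.Properties as ℤ
import Data.Integer.Tactic.RingSolver as ℤ-Solver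
open import Relation.Nullary.Decidable using (dec⇒maybe)
open import Data.Product using (_×_; _,_; proj₁)
open import Data.Rational using (0ℚ; _+_; _/_; toℚᵘ)
open import Data.Rational.Properties
  using (+-*-commutativeRing; _≟_; toℚᵘ-injective; toℚᵘ-homo-+; toℚᵘ-homo-*; toℚᵘ-fromℚᵘ;
         +-assoc; +-comm; +-identityˡ; +-identityʳ; +-inverseˡ; +-inverseʳ; *-assoc; *-identityʳ)
open import Data.Rational.Unnormalised as ℚᵘ using (mkℚᵘ; *≡*)
import Data.Rational.Unnormalised.Properties as ℚᵘ
open import Level using (0ℓ)
open import Tactic.RingSolver using (solve-∀)
import Tactic.RingSolver.Core.AlmostCommutativeRing as ACR
open ≡ using (refl; cong; cong₂; sym; trans; module ≡-Reasoning)

ℚ-ring : ACR.AlmostCommutativeRing 0ℓ 0ℓ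
ℚ-ring = ACR.fromCommutativeRing +-*-commutativeRing (λ x → dec⇒maybe (0ℚ ≟ x))

private
  toℚᵘ-/ : ∀ i d → toℚᵘ (i / suc d) ℚᵘ.≃ mkℚᵘ i d
  toℚᵘ-/ i d = toℚᵘ-fromℚᵘ (mkℚᵘ i d)

ℕ→ℚ-+ : ∀ a b → ℕ→ℚ (a +ℕ b) ≡ ℕ→ℚ a + ℕ→ℚ b
ℕ→ℚ-+ a b = toℚᵘ-injective (begin
  toℚᵘ (ℕ→ℚ (a +ℕ b))                  ≈⟨ toℚᵘ-/ (+ (a +ℕ b)) 0 ⟩
  mkℚᵘ (+ (a +ℕ b)) 0                  ≈⟨ *≡* (trans (cong (ℤ._* + 1) (ℤ.pos-+ a b)) (unit (+ a) (+ b))) ⟩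
  mkℚᵘ (+ a) 0 ℚᵘ.+ mkℚᵘ (+ b) 0       ≈⟨ ℚᵘ.+-cong (toℚᵘ-/ (+ a) 0) (toℚᵘ-/ (+ b) 0) ⟨
  toℚᵘ (ℕ→ℚ a) ℚᵘ.+ toℚᵘ (ℕ→ℚ b)       ≈⟨ toℚᵘ-homo-+ (ℕ→ℚ a) (ℕ→ℚ b) ⟨
  toℚᵘ (ℕ→ℚ a + ℕ→ℚ b)                 ∎)
  where
  open ℚᵘ.≃-Reasoning
  unit : ∀ x y → (x ℤ.+ y) ℤ.* + 1 ≡ (x ℤ.* + 1 ℤ.+ y ℤ.* + 1) ℤ.* + 1
  unit = ℤ-Solver.solve-∀

ℕ→ℚ-* : ∀ a b → ℕ→ℚ (a *ℕ b) ≡ ℕ→ℚ a * ℕ→ℚ b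
ℕ→ℚ-* a b = toℚᵘ-injective (begin
  toℚᵘ (ℕ→ℚ (a *ℕ b))                  ≈⟨ toℚᵘ-/ (+ (a *ℕ b)) 0 ⟩
  mkℚᵘ (+ (a *ℕ b)) 0                  ≈⟨ *≡* (cong (ℤ._* + 1) (ℤ.pos-* a b)) ⟩
  mkℚᵘ (+ a) 0 ℚᵘ.* mkℚᵘ (+ b) 0       ≈⟨ ℚᵘ.*-cong (toℚᵘ-/ (+ a) 0) (toℚᵘ-/ (+ b) 0) ⟨
  toℚᵘ (ℕ→ℚ a) ℚᵘ.* toℚᵘ (ℕ→ℚ b)       ≈⟨ toℚᵘ-homo-* (ℕ→ℚ a) (ℕ→ℚ b) ⟨
  toℚᵘ (ℕ→ℚ a * ℕ→ℚ b)                 ∎)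
  where open ℚᵘ.≃-Reasoning

ℕ→ℚ-^ : ∀ a m → ℕ→ℚ (a ℕ.^ m) ≡ ℕ→ℚ a ^ m
ℕ→ℚ-^ a zero    = refl
ℕ→ℚ-^ a (suc m) = trans (ℕ→ℚ-* a (a ℕ.^ m)) (cong (ℕ→ℚ a *_) (ℕ→ℚ-^ a m))

/-*-ℕ→ℚ : ∀ a d .{{_ : ℕ.NonZero d}} → (+ a) / d * ℕ→ℚ d ≡ ℕ→ℚ a
/-*-ℕ→ℚ a (suc d) = toℚᵘ-injective (begin
  toℚᵘ ((+ a) / suc d * ℕ→ℚ (suc d))          ≈⟨ toℚᵘ-homo-* ((+ a) / suc d) (ℕ→ℚ (suc d)) ⟩
  toℚᵘ ((+ a) / suc d) ℚᵘ.* toℚᵘ (ℕ→ℚ (suc d)) ≈⟨ ℚᵘ.*-cong (toℚᵘ-/ (+ a) d) (toℚᵘ-/ (+ suc d) 0) ⟩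
  mkℚᵘ (+ a) d ℚᵘ.* mkℚᵘ (+ suc d) 0          ≈⟨ *≡* (trans (ℤ.*-identityʳ _)
                                                     (cong (λ k → + a ℤ.* + k) (sym (ℕ.*-identityʳ (suc d))))) ⟩
  mkℚᵘ (+ a) 0                                ≈⟨ toℚᵘ-/ (+ a) 0 ⟨
  toℚᵘ (ℕ→ℚ a)                                ∎)
  where open ℚᵘ.≃-Reasoning

^-distrib-* : ∀ x y n → (x * y) ^ n ≡ x ^ n * y ^ n
^-distrib-* x y zero    = refl
^-distrib-* x y (suc n) = trans (cong (x * y *_) (^-distrib-* x y n)) (interchange x y (x ^ n) (y ^ n))
  where
  interchange : ∀ x y u v → x * y * (u * v) ≡ x * u * (y * v)
  interchange = solve-∀ ℚ-ring

1ℚ^n≡1ℚ : ∀ n → 1ℚ ^ n ≡ 1ℚ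
1ℚ^n≡1ℚ zero    = refl
1ℚ^n≡1ℚ (suc n) = cong (1ℚ *_) (1ℚ^n≡1ℚ n)

*-cancelʳ-invertible : ∀ {x y} z w → z * w ≡ 1ℚ → x * z ≡ y * z → x ≡ y
*-cancelʳ-invertible {x} {y} z w zw≡1 xz≡yz = begin
  x               ≡⟨ *-identityʳ x ⟨
  x * 1ℚ          ≡⟨ cong (x *_) zw≡1 ⟨
  x * (z * w)     ≡⟨ *-assoc x z w ⟨
  (x * z) * w     ≡⟨ cong (_* w) xz≡yz ⟩
  (y * z) * w     ≡⟨ *-assoc y z w ⟩
  y * (z * w)     ≡⟨ cong (y *_) zw≡1 ⟩
  y * 1ℚ          ≡⟨ *-identityʳ y ⟩
  y               ∎
  where open ≡-Reasoning

-- ℚ[x]/(x² - κ), the pair (a , b) standing for a + b√κ.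
module QuadraticExtension (κ : ℚ) where

  ℚ[√κ] : Set
  ℚ[√κ] = ℚ × ℚ

  infixl 6 _+′_
  infixl 7 _*′_
  infix  8 -′_

  _+′_ _*′_ : ℚ[√κ] → ℚ[√κ] → ℚ[√κ]
  (a , b) +′ (c , d) = (a + c , b + d)
  (a , b) *′ (c , d) = (a * c + κ * (b * d) , a * d + b * c)

  -′_ : ℚ[√κ] → ℚ[√κ]
  -′ (a , b) = (- a , - b)

  ι : ℚ → ℚ[√κ]
  ι a = (a , 0ℚ)

  √κ : ℚ[√κ]
  √κ = (0ℚ , 1ℚ)

  isCommutativeRing : IsCommutativeRing _≡_ _+′_ _*′_ -′_ (ι 0ℚ) (ι 1ℚ)
  isCommutativeRing = record
    { isRing = record
      { +-isAbelianGroup = record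
        { isGroup = record
          { isMonoid = record
            { isSemigroup = record
              { isMagma = record { isEquivalence = ≡.isEquivalence ; ∙-cong = cong₂ _+′_ }
              ; assoc = λ (a , b) (c , d) (e , f) → cong₂ _,_ (+-assoc a c e) (+-assoc b d f) }
            ; identity = (λ (a , b) → cong₂ _,_ (+-identityˡ a) (+-identityˡ b))
                       , (λ (a , b) → cong₂ _,_ (+-identityʳ a) (+-identityʳ b)) }
          ; inverse = (λ (a , b) → cong₂ _,_ (+-inverseˡ a) (+-inverseˡ b))
                    , (λ (a , b) → cong₂ _,_ (+-inverseʳ a) (+-inverseʳ b))
          ; ⁻¹-cong = cong -′_ }
        ; comm = λ (a , b) (c , d) → cong₂ _,_ (+-comm a c) (+-comm b d) }
      ; *-cong = cong₂ _*′_
      ; *-assoc = λ (a , b) (c , d) (e , f) → cong₂ _,_ (assoc₁ κ a b c d e f) (assoc₂ κ a b c d e f)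
      ; *-identity = (λ (a , b) → cong₂ _,_ (identityˡ₁ κ a b) (identityˡ₂ a b))
                   , (λ (a , b) → cong₂ _,_ (identityʳ₁ κ a b) (identityʳ₂ a b))
      ; distrib = (λ (a , b) (c , d) (e , f) → cong₂ _,_ (distribˡ₁ κ a b c d e f) (distribˡ₂ a b c d e f))
                , (λ (a , b) (c , d) (e , f) → cong₂ _,_ (distribʳ₁ κ a b c d e f) (distribʳ₂ a b c d e f)) }
    ; *-comm = λ (a , b) (c , d) → cong₂ _,_ (comm₁ κ a b c d) (comm₂ a b c d) }
    where
    assoc₁ : ∀ k a b c d e f → (a * c + k * (b * d)) * e + k * ((a * d + b * c) * f)
                              ≡ a * (c * e + k * (d * f)) + k * (b * (c * f + d * e))
    assoc₁ = solve-∀ ℚ-ring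
    assoc₂ : ∀ k a b c d e f → (a * c + k * (b * d)) * f + (a * d + b * c) * e
                              ≡ a * (c * f + d * e) + b * (c * e + k * (d * f))
    assoc₂ = solve-∀ ℚ-ring
    identityˡ₁ : ∀ k a b → 1ℚ * a + k * (0ℚ * b) ≡ a
    identityˡ₁ = solve-∀ ℚ-ring
    identityˡ₂ : ∀ a b → 1ℚ * b + 0ℚ * a ≡ b
    identityˡ₂ = solve-∀ ℚ-ring
    identityʳ₁ : ∀ k a b → a * 1ℚ + k * (b * 0ℚ) ≡ a
    identityʳ₁ = solve-∀ ℚ-ring
    identityʳ₂ : ∀ a b → a * 0ℚ + b * 1ℚ ≡ b
    identityʳ₂ = solve-∀ ℚ-ring
    distribˡ₁ : ∀ k a b c d e f → a * (c + e) + k * (b * (d + f)) ≡ (a * c + k * (b * d)) + (a * e + k * (b * f))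
    distribˡ₁ = solve-∀ ℚ-ring
    distribˡ₂ : ∀ a b c d e f → a * (d + f) + b * (c + e) ≡ (a * d + b * c) + (a * f + b * e)
    distribˡ₂ = solve-∀ ℚ-ring
    distribʳ₁ : ∀ k a b c d e f → (c + e) * a + k * ((d + f) * b) ≡ (c * a + k * (d * b)) + (e * a + k * (f * b))
    distribʳ₁ = solve-∀ ℚ-ring
    distribʳ₂ : ∀ a b c d e f → (c + e) * b + (d + f) * a ≡ (c * b + d * a) + (e * b + f * a)
    distribʳ₂ = solve-∀ ℚ-ring
    comm₁ : ∀ k a b c d → a * c + k * (b * d) ≡ c * a + k * (d * b)
    comm₁ = solve-∀ ℚ-ring
    comm₂ : ∀ a b c d → a * d + b * c ≡ c * b + d * a
    comm₂ = solve-∀ ℚ-ring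

  commutativeRing : CommutativeRing 0ℓ 0ℓ
  commutativeRing = record { isCommutativeRing = isCommutativeRing }

  open OddPowers commutativeRing public using (∑≤; ∑≤-cong; binet; binet-zero; binet-recurrence; binet-odd-power)
  open import Algebra.Properties.Semiring.Exp (CommutativeRing.semiring commutativeRing) public
    using () renaming (_^_ to _^′_)
  open import Algebra.Properties.Semiring.Mult (CommutativeRing.semiring commutativeRing) public
    using () renaming (_×_ to _×′_)

  ι-injective : ∀ {p q} → ι p ≡ ι q → p ≡ q
  ι-injective = cong proj₁

  ι-* : ∀ p q → ι (p * q) ≡ ι p *′ ι q
  ι-* p q = cong₂ _,_ (first κ p q) (second p q)
    where
    first : ∀ k p q → p * q ≡ p * q + k * (0ℚ * 0ℚ)
    first = solve-∀ ℚ-ring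
    second : ∀ p q → 0ℚ ≡ p * 0ℚ + 0ℚ * q
    second = solve-∀ ℚ-ring

  ι-^ : ∀ p n → ι (p ^ n) ≡ ι p ^′ n
  ι-^ p zero    = refl
  ι-^ p (suc n) = trans (ι-* p (p ^ n)) (cong (ι p *′_) (ι-^ p n))

  ι-ℕ→ℚ : ∀ k → ι (ℕ→ℚ k) ≡ k ×′ ι 1ℚ
  ι-ℕ→ℚ zero    = refl
  ι-ℕ→ℚ (suc k) = trans (cong ι (ℕ→ℚ-+ 1 k)) (cong (ι 1ℚ +′_) (ι-ℕ→ℚ k))

  ι-Σ≤ : ∀ m f → ι (Σ≤ m f) ≡ ∑≤ m (ι ∘ f)
  ι-Σ≤ zero    f = refl
  ι-Σ≤ (suc m) f = cong (_+′ ι (f (suc m))) (ι-Σ≤ m f)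

module PellBinet (r : ℕ) where

  R H T κ ω X : ℚ
  R = Rq r
  H = ROverTwo r
  T = twoOverR r
  κ = prefactor r 1
  -- ω √κ = W/2, so that φ, ψ below are the paper's λ, μ.
  ω = (+ (Rℕ r *ℕ Rℕ r *ℕ (2 +ℕ Rℕ r))) / 4
  X = R * R * R * (ℕ→ℚ 2 + R)

  private
    instance
      R≢0 : ℕ.NonZero (Rℕ r)
      R≢0 = ℕ.m^n≢0 2 r

  H*2≡R : H * ℕ→ℚ 2 ≡ R
  H*2≡R = /-*-ℕ→ℚ (Rℕ r) 2

  T*R≡2 : T * R ≡ ℕ→ℚ 2
  T*R≡2 = /-*-ℕ→ℚ 2 (Rℕ r)

  ω*4≡R*R*[2+R] : ω * ℕ→ℚ 4 ≡ R * R * (ℕ→ℚ 2 + R)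
  ω*4≡R*R*[2+R] = trans (/-*-ℕ→ℚ (Rℕ r *ℕ Rℕ r *ℕ (2 +ℕ Rℕ r)) 4)
    (trans (ℕ→ℚ-* (Rℕ r *ℕ Rℕ r) (2 +ℕ Rℕ r)) (cong₂ _*_ (ℕ→ℚ-* (Rℕ r) (Rℕ r)) (ℕ→ℚ-+ 2 (Rℕ r))))

  prefactor*X^m≡4^m : ∀ m → prefactor r m * X ^ m ≡ ℕ→ℚ 4 ^ m
  prefactor*X^m≡4^m m = begin
    prefactor r m * X ^ m            ≡⟨ cong (prefactor r m *_) denominator ⟨
    prefactor r m * ℕ→ℚ D            ≡⟨ /-*-ℕ→ℚ (2 ℕ.^ (2 *ℕ m)) D ⟩
    ℕ→ℚ (2 ℕ.^ (2 *ℕ m))             ≡⟨ cong ℕ→ℚ (ℕ.^-*-assoc 2 2 m) ⟨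
    ℕ→ℚ (4 ℕ.^ m)                    ≡⟨ ℕ→ℚ-^ 4 m ⟩
    ℕ→ℚ 4 ^ m                        ∎
    where
    open ≡-Reasoning
    D = Rℕ r ℕ.^ (3 *ℕ m) *ℕ (2 +ℕ Rℕ r) ℕ.^ m
    instance
      D≢0 : ℕ.NonZero D
      D≢0 = ℕ.m*n≢0 _ _ {{ℕ.m^n≢0 (Rℕ r) (3 *ℕ m)}} {{ℕ.m^n≢0 (2 +ℕ Rℕ r) m}}
    R³[2+R]≡X : ℕ→ℚ (Rℕ r ℕ.^ 3) * ℕ→ℚ (2 +ℕ Rℕ r) ≡ X
    R³[2+R]≡X = trans (cong₂ _*_ (ℕ→ℚ-^ (Rℕ r) 3) (ℕ→ℚ-+ 2 (Rℕ r))) (cube R (ℕ→ℚ 2 + R))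
      where
      cube : ∀ x y → x * (x * (x * 1ℚ)) * y ≡ x * x * x * y
      cube = solve-∀ ℚ-ring
    denominator : ℕ→ℚ D ≡ X ^ m
    denominator = begin
      ℕ→ℚ D
        ≡⟨ ℕ→ℚ-* (Rℕ r ℕ.^ (3 *ℕ m)) ((2 +ℕ Rℕ r) ℕ.^ m) ⟩
      ℕ→ℚ (Rℕ r ℕ.^ (3 *ℕ m)) * ℕ→ℚ ((2 +ℕ Rℕ r) ℕ.^ m)
        ≡⟨ cong (λ k → ℕ→ℚ k * ℕ→ℚ ((2 +ℕ Rℕ r) ℕ.^ m)) (ℕ.^-*-assoc (Rℕ r) 3 m) ⟨
      ℕ→ℚ ((Rℕ r ℕ.^ 3) ℕ.^ m) * ℕ→ℚ ((2 +ℕ Rℕ r) ℕ.^ m)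
        ≡⟨ cong₂ _*_ (ℕ→ℚ-^ (Rℕ r ℕ.^ 3) m) (ℕ→ℚ-^ (2 +ℕ Rℕ r) m) ⟩
      ℕ→ℚ (Rℕ r ℕ.^ 3) ^ m * ℕ→ℚ (2 +ℕ Rℕ r) ^ m
        ≡⟨ ^-distrib-* (ℕ→ℚ (Rℕ r ℕ.^ 3)) (ℕ→ℚ (2 +ℕ Rℕ r)) m ⟨
      (ℕ→ℚ (Rℕ r ℕ.^ 3) * ℕ→ℚ (2 +ℕ Rℕ r)) ^ m
        ≡⟨ cong (_^ m) R³[2+R]≡X ⟩
      X ^ m ∎

  κ*X≡4 : κ * X ≡ ℕ→ℚ 4
  κ*X≡4 = trans (cong (κ *_) (sym (*-identityʳ X))) (trans (prefactor*X^m≡4^m 1) (*-identityʳ (ℕ→ℚ 4)))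

  prefactor≡κ^m : ∀ m → prefactor r m ≡ κ ^ m
  prefactor≡κ^m m = *-cancelʳ-invertible (X ^ m) ((κ * ¼) ^ m) X^m-inverse (begin
    prefactor r m * X ^ m   ≡⟨ prefactor*X^m≡4^m m ⟩
    ℕ→ℚ 4 ^ m               ≡⟨ cong (_^ m) κ*X≡4 ⟨
    (κ * X) ^ m             ≡⟨ ^-distrib-* κ X m ⟩
    κ ^ m * X ^ m           ∎)
    where
    open ≡-Reasoning
    ¼ = + 1 / 4
    X^m-inverse : X ^ m * (κ * ¼) ^ m ≡ 1ℚ
    X^m-inverse = begin
      X ^ m * (κ * ¼) ^ m     ≡⟨ ^-distrib-* X (κ * ¼) m ⟨
      (X * (κ * ¼)) ^ m       ≡⟨ cong (_^ m) (regroup X κ ¼) ⟩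
      ((κ * X) * ¼) ^ m       ≡⟨ cong (λ y → (y * ¼) ^ m) κ*X≡4 ⟩
      1ℚ ^ m                  ≡⟨ 1ℚ^n≡1ℚ m ⟩
      1ℚ                      ∎
      where
      regroup : ∀ x k q → x * (k * q) ≡ (k * x) * q
      regroup = solve-∀ ℚ-ring

  H+H≡R : H + H ≡ R
  H+H≡R = trans (double H) H*2≡R
    where
    double : ∀ x → x + x ≡ x * ℕ→ℚ 2
    double = solve-∀ ℚ-ring

  κ*ω²≡H²+H : κ * (ω * ω) ≡ H * H + H
  κ*ω²≡H²+H = *-cancelʳ-invertible (ℕ→ℚ 16) (+ 1 / 16) refl (begin
    κ * (ω * ω) * ℕ→ℚ 16                          ≡⟨ step₁ κ ω ⟩
    κ * ((ω * ℕ→ℚ 4) * (ω * ℕ→ℚ 4))               ≡⟨ cong (λ y → κ * (y * y)) ω*4≡R*R*[2+R] ⟩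
    κ * ((R * R * (ℕ→ℚ 2 + R)) * (R * R * (ℕ→ℚ 2 + R))) ≡⟨ step₂ κ R ⟩
    (κ * X) * (R * (ℕ→ℚ 2 + R))                   ≡⟨ cong (_* (R * (ℕ→ℚ 2 + R))) κ*X≡4 ⟩
    ℕ→ℚ 4 * (R * (ℕ→ℚ 2 + R))                     ≡⟨ cong (λ y → ℕ→ℚ 4 * (y * (ℕ→ℚ 2 + y))) H*2≡R ⟨
    ℕ→ℚ 4 * (H * ℕ→ℚ 2 * (ℕ→ℚ 2 + H * ℕ→ℚ 2))   ≡⟨ step₃ H ⟩
    (H * H + H) * ℕ→ℚ 16                          ∎)
    where
    open ≡-Reasoning
    step₁ : ∀ k w → k * (w * w) * ℕ→ℚ 16 ≡ k * ((w * ℕ→ℚ 4) * (w * ℕ→ℚ 4))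
    step₁ = solve-∀ ℚ-ring
    step₂ : ∀ k x → k * ((x * x * (ℕ→ℚ 2 + x)) * (x * x * (ℕ→ℚ 2 + x)))
                    ≡ (k * (x * x * x * (ℕ→ℚ 2 + x))) * (x * (ℕ→ℚ 2 + x))
    step₂ = solve-∀ ℚ-ring
    step₃ : ∀ h → ℕ→ℚ 4 * (h * ℕ→ℚ 2 * (ℕ→ℚ 2 + h * ℕ→ℚ 2)) ≡ (h * h + h) * ℕ→ℚ 16
    step₃ = solve-∀ ℚ-ring

  κ*ω+κ*ω≡T : κ * ω + κ * ω ≡ T
  κ*ω+κ*ω≡T = *-cancelʳ-invertible (R * ℕ→ℚ 4) (T * (+ 1 / 8)) R*4-inverse (begin
    (κ * ω + κ * ω) * (R * ℕ→ℚ 4)                  ≡⟨ step₁ κ ω R ⟩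
    ℕ→ℚ 2 * (κ * ((ω * ℕ→ℚ 4) * R))                ≡⟨ cong (λ y → ℕ→ℚ 2 * (κ * (y * R))) ω*4≡R*R*[2+R] ⟩
    ℕ→ℚ 2 * (κ * ((R * R * (ℕ→ℚ 2 + R)) * R))      ≡⟨ step₂ κ R ⟩
    ℕ→ℚ 2 * (κ * X)                                ≡⟨ cong (ℕ→ℚ 2 *_) κ*X≡4 ⟩
    ℕ→ℚ 2 * ℕ→ℚ 4                                  ≡⟨ cong (_* ℕ→ℚ 4) T*R≡2 ⟨
    (T * R) * ℕ→ℚ 4                                ≡⟨ step₃ T R ⟩
    T * (R * ℕ→ℚ 4)                                ∎)
    where
    open ≡-Reasoning
    step₁ : ∀ k w x → (k * w + k * w) * (x * ℕ→ℚ 4) ≡ ℕ→ℚ 2 * (k * ((w * ℕ→ℚ 4) * x))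
    step₁ = solve-∀ ℚ-ring
    step₂ : ∀ k x → ℕ→ℚ 2 * (k * ((x * x * (ℕ→ℚ 2 + x)) * x)) ≡ ℕ→ℚ 2 * (k * (x * x * x * (ℕ→ℚ 2 + x)))
    step₂ = solve-∀ ℚ-ring
    step₃ : ∀ t x → (t * x) * ℕ→ℚ 4 ≡ t * (x * ℕ→ℚ 4)
    step₃ = solve-∀ ℚ-ring
    R*4-inverse : R * ℕ→ℚ 4 * (T * (+ 1 / 8)) ≡ 1ℚ
    R*4-inverse = trans (regroup R T) (cong (λ y → y * (ℕ→ℚ 4 * (+ 1 / 8))) T*R≡2)
      where
      regroup : ∀ x t → x * ℕ→ℚ 4 * (t * (+ 1 / 8)) ≡ (t * x) * (ℕ→ℚ 4 * (+ 1 / 8))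
      regroup = solve-∀ ℚ-ring

  open QuadraticExtension κ public

  φ ψ : ℚ[√κ]
  φ = (H , ω)
  ψ = (H , - ω)

  char-root : ∀ σ → κ * (σ * σ) ≡ H * H + H → (H , σ) *′ (H , σ) ≡ ι R *′ (H , σ) +′ ι H
  char-root σ κσ² = cong₂ _,_ first (trans (second H σ) (cong (λ y → y * σ + 0ℚ * H + 0ℚ) H+H≡R))
    where
    open ≡-Reasoning
    first : H * H + κ * (σ * σ) ≡ R * H + κ * (0ℚ * σ) + H
    first = begin
      H * H + κ * (σ * σ)                 ≡⟨ cong (λ y → H * H + y) κσ² ⟩
      H * H + (H * H + H)                 ≡⟨ regroup κ H σ ⟩
      (H + H) * H + κ * (0ℚ * σ) + H      ≡⟨ cong (λ y → y * H + κ * (0ℚ * σ) + H) H+H≡R ⟩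
      R * H + κ * (0ℚ * σ) + H            ∎
      where
      regroup : ∀ k h s → h * h + (h * h + h) ≡ (h + h) * h + k * (0ℚ * s) + h
      regroup = solve-∀ ℚ-ring
    second : ∀ h s → h * s + s * h ≡ (h + h) * s + 0ℚ * h + 0ℚ
    second = solve-∀ ℚ-ring

  φ²≡Rφ+H : φ *′ φ ≡ ι R *′ φ +′ ι H
  φ²≡Rφ+H = char-root ω κ*ω²≡H²+H

  ψ²≡Rψ+H : ψ *′ ψ ≡ ι R *′ ψ +′ ι H
  ψ²≡Rψ+H = char-root (- ω) (trans (neg-square κ ω) κ*ω²≡H²+H)
    where
    neg-square : ∀ k w → k * (- w * - w) ≡ k * (w * w)
    neg-square = solve-∀ ℚ-ring

  φψ≡ι[-H] : φ *′ ψ ≡ ι (- H)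
  φψ≡ι[-H] = cong₂ _,_ (trans (first κ H ω) (trans (cong (λ y → H * H + - y) κ*ω²≡H²+H) (simplify H))) (second H ω)
    where
    first : ∀ k h w → h * h + k * (w * - w) ≡ h * h + - (k * (w * w))
    first = solve-∀ ℚ-ring
    simplify : ∀ h → h * h + - (h * h + h) ≡ - h
    simplify = solve-∀ ℚ-ring
    second : ∀ h w → h * - w + w * h ≡ 0ℚ
    second = solve-∀ ℚ-ring

  binet-one : binet √κ φ ψ 1 ≡ ι T
  binet-one = cong₂ _,_ (trans (first κ H ω) κ*ω+κ*ω≡T) (second κ H ω)
    where
    first : ∀ k h w → 0ℚ * (h * 1ℚ + k * (w * 0ℚ) + - (h * 1ℚ + k * (- w * 0ℚ)))
                      + k * (1ℚ * (h * 0ℚ + w * 1ℚ + - (h * 0ℚ + - w * 1ℚ))) ≡ k * w + k * w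
    first = solve-∀ ℚ-ring
    second : ∀ k h w → 0ℚ * (h * 0ℚ + w * 1ℚ + - (h * 0ℚ + - w * 1ℚ))
                       + 1ℚ * (h * 1ℚ + k * (w * 0ℚ) + - (h * 1ℚ + k * (- w * 0ℚ))) ≡ 0ℚ
    second = solve-∀ ℚ-ring

  P≡binet : ∀ n → ι (P r n) ≡ binet √κ φ ψ n
  P≡binet zero          = sym (binet-zero √κ φ ψ)
  P≡binet (suc zero)    = sym binet-one
  P≡binet (suc (suc n)) = begin
    ι (R * P r (suc n)) +′ ι (H * P r n)              ≡⟨ cong₂ _+′_ (ι-* R (P r (suc n))) (ι-* H (P r n)) ⟩
    ι R *′ ι (P r (suc n)) +′ ι H *′ ι (P r n)        ≡⟨ cong₂ (λ x y → ι R *′ x +′ ι H *′ y) (P≡binet (suc n)) (P≡binet n) ⟩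
    ι R *′ binet √κ φ ψ (suc n) +′ ι H *′ binet √κ φ ψ n
      ≡⟨ binet-recurrence √κ φ ψ (ι R) (ι H) φ²≡Rφ+H ψ²≡Rψ+H n ⟨
    binet √κ φ ψ (suc (suc n))                        ∎
    where open ≡-Reasoning

  √κ²≡ικ : √κ *′ √κ ≡ ι κ
  √κ²≡ικ = cong₂ _,_ (first κ) second
    where
    first : ∀ k → 0ℚ * 0ℚ + k * (1ℚ * 1ℚ) ≡ k
    first = solve-∀ ℚ-ring
    second : 0ℚ * 1ℚ + 1ℚ * 0ℚ ≡ 0ℚ
    second = refl

  term : ℕ → ℕ → ℕ → ℚ
  term m n j = ((- 1ℚ) ^ j) * ℕ→ℚ ((2 *ℕ m +ℕ 1) C j)
               * P r ((2 *ℕ m +ℕ 1 ∸ 2 *ℕ j) *ℕ n)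
               * ((- ROverTwo r) ^ (j *ℕ n))

  ι-term : ∀ m n j → ι (term m n j)
    ≡ (-′ ι 1ℚ) ^′ j *′ ((2 *ℕ m +ℕ 1) C j) ×′ ι 1ℚ
      *′ binet √κ φ ψ ((2 *ℕ m +ℕ 1 ∸ 2 *ℕ j) *ℕ n) *′ (φ *′ ψ) ^′ (j *ℕ n)
  ι-term m n j = begin
    ι (a * b * c * d)              ≡⟨ trans (ι-* (a * b * c) d) (cong (_*′ ι d) (trans (ι-* (a * b) c) (cong (_*′ ι c) (ι-* a b)))) ⟩
    ι a *′ ι b *′ ι c *′ ι d       ≡⟨ cong₂ _*′_ (cong₂ _*′_ (cong₂ _*′_ (ι-^ (- 1ℚ) j) (ι-ℕ→ℚ ((2 *ℕ m +ℕ 1) C j))) (P≡binet ((2 *ℕ m +ℕ 1 ∸ 2 *ℕ j) *ℕ n)))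
                                                 (trans (ι-^ (- H) (j *ℕ n)) (cong (_^′ (j *ℕ n)) (sym φψ≡ι[-H]))) ⟩
    _                              ∎
    where
    open ≡-Reasoning
    a = (- 1ℚ) ^ j
    b = ℕ→ℚ ((2 *ℕ m +ℕ 1) C j)
    c = P r ((2 *ℕ m +ℕ 1 ∸ 2 *ℕ j) *ℕ n)
    d = (- H) ^ (j *ℕ n)

mainTheorem4 : (r m n : ℕ) →
    P r n ^ (2 *ℕ m +ℕ 1)
      ≡ prefactor r m
        * Σ≤ m (λ j → ((- 1ℚ) ^ j) * ℕ→ℚ ((2 *ℕ m +ℕ 1) C j)
                      * P r ((2 *ℕ m +ℕ 1 ∸ 2 *ℕ j) *ℕ n)
                      * ((- ROverTwo r) ^ (j *ℕ n)))
mainTheorem4 r m n = ι-injective (begin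
  ι (P r n ^ k)                                 ≡⟨ ι-^ (P r n) k ⟩
  ι (P r n) ^′ k                                ≡⟨ cong (_^′ k) (P≡binet n) ⟩
  binet √κ φ ψ n ^′ k                           ≡⟨ binet-odd-power √κ φ ψ m n ⟩
  (√κ *′ √κ) ^′ m *′ ∑≤ m _                     ≡⟨ cong₂ _*′_ [√κ²]^m≡ι[prefactor] (∑≤-cong m (λ j _ → sym (ι-term m n j))) ⟩
  ι (prefactor r m) *′ ∑≤ m (ι ∘ term m n)      ≡⟨ cong (ι (prefactor r m) *′_) (ι-Σ≤ m (term m n)) ⟨
  ι (prefactor r m) *′ ι (Σ≤ m (term m n))      ≡⟨ ι-* (prefactor r m) (Σ≤ m (term m n)) ⟨
  ι (prefactor r m * Σ≤ m (term m n))           ∎)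
  where
  open PellBinet r
  open ≡-Reasoning
  k = 2 *ℕ m +ℕ 1
  [√κ²]^m≡ι[prefactor] : (√κ *′ √κ) ^′ m ≡ ι (prefactor r m)
  [√κ²]^m≡ι[prefactor] = trans (cong (_^′ m) √κ²≡ικ) (trans (sym (ι-^ κ m)) (cong ι (sym (prefactor≡κ^m m))))
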